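{- Let $G$ be a finite group, $S$ a set of generators of $G$ with $e\in S=S^{ -1}$, $\mathfrak{X}_C$ the configuration coming from $\mathrm{Cay}(G,S)$, and $D=\mathrm{diam}\,\mathrm{Cay}(G,S)$. Then $$WL(\mathfrak{X}_C)\leq\begin{cases}\lceil\log_2(D-1)\rceil & \text{if for every } g\in G \text{ there is exactly one } g' \text{ with } d(g,g')=D,\\ \lceil\log_2 D\rceil & \text{otherwise.}\end{cases}$$
   Context: The Cayley graph $\mathrm{Cay}(G,S)$ has vertex set $G$ and edges $(g,sg)$, $g\in G$, $s\in S$; $d$ is directed graph distance and $D$ its maximum. The configuration $\mathfrak{X}_C=(G,c)$ has $c(g_1,g_2)=g_2g_1^{ -1}$ if $g_2g_1^{ -1}\in S$ and $c(g_1,g_2)=\emptyset$ (a special symbol) otherwise. Weisfeiler-Leman algorithm: $c^{(0)}=c$, $\mathcal{C}^{(0)}$ the set of colours, and $c^{(h+1)}(v_1,v_2)$ is the tuple consisting of $c^{(h)}(v_1,v_2)$ together with the numbers $\left|\{w: c^{(h)}(v_1,w)=c_1,\ c^{(h)}(w,v_2)=c_2\}\right|$ for all $(c_1,c_2)\in\mathcal{C}^{(h)}\times\mathcal{C}^{(h)}$; $\mathcal{C}^{(h+1)}$ is the set of values of $c^{(h+1)}$. $WL(\mathfrak{X}_C)$ is the least $h\geq0$ such that the partition of $G^2$ into colour classes of $c^{(h+1)}$ equals that of $c^{(h)}$. -}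

module Defs where

open import Data.Nat using (ℕ; zero; suc; _<_; _≤_; _+_; _≡ᵇ_)
open import Data.Nat.ListAction using (sum)
open import Data.Bool.ListAction using (all; any)
open import Data.Fin using (Fin)
open import Data.Fin.Properties using (_≟_)
open import Data.Fin.Subset using (Subset; _∈_)
open import Data.Fin.Subset.Properties using (_∈?_)
open import Data.Bool using (Bool; true; false; _∧_; _∨_; if_then_else_; T)
open import Data.List using (List; allFin; map)
open import Data.Maybe using (Maybe; just; nothing)
open import Data.Product using (_×_; _,_; ∃; ∃-syntax)
open import Relation.Nullary using (¬_; does)
open import Relation.Binary.PropositionalEquality using (_≡_)

-- A finite group is modelled with carrier Fin n (every finite group is
-- isomorphic to such a group); the group laws are supplied separately.
module Cayley (n : ℕ) (_∙_ : Fin n → Fin n → Fin n) (_⁻¹ : Fin n → Fin n)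
              (S : Subset n) where

  G : List (Fin n)
  G = allFin n

  data Word : Fin n → Set where
    one   : (g : Fin n) → g ∈ S → Word g
    times : {g h : Fin n} → Word g → Word h → Word (g ∙ h)

  Generates : Set
  Generates = (g : Fin n) → Word g

  -- Cayley graph Cay(G,S): edges g → s g, s ∈ S.
  -- walk k g g' : there is a directed walk of length exactly k from g to g'.
  walk : ℕ → Fin n → Fin n → Bool
  walk zero g g' = does (g ≟ g')
  walk (suc k) g g' = any (λ s → does (s ∈? S) ∧ walk k (s ∙ g) g') G

  Dist : Fin n → Fin n → ℕ → Set
  Dist g g' k = T (walk k g g') × ((j : ℕ) → j < k → ¬ T (walk j g g'))

  IsDiameter : ℕ → Set
  IsDiameter D = ((g g' : Fin n) → ∃[ k ] (k ≤ D × Dist g g' k))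
               × ∃[ g ] ∃[ g' ] Dist g g' D

  UniqueAntipodes : ℕ → Set
  UniqueAntipodes D = (g : Fin n) →
    ∃[ g' ] (Dist g g' D × ((g'' : Fin n) → Dist g g'' D → g'' ≡ g'))

  -- The configuration X_C: c(g1,g2) = g2 g1⁻¹ if in S, ∅ (= nothing) otherwise.
  c : Fin n → Fin n → Maybe (Fin n)
  c g₁ g₂ = if does ((g₂ ∙ (g₁ ⁻¹)) ∈? S) then just (g₂ ∙ (g₁ ⁻¹)) else nothing

  eqM : Maybe (Fin n) → Maybe (Fin n) → Bool
  eqM (just x) (just y) = does (x ≟ y)
  eqM nothing  nothing  = true
  eqM _        _        = false

  count : (Fin n → Bool) → ℕ
  count P = sum (map (λ w → if P w then 1 else 0) G)

  -- same h (v₁,v₂) (u₁,u₂) = true iff c^{(h)}(v₁,v₂) = c^{(h)}(u₁,u₂).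
  -- Colours of C^{(h)} are represented by pairs (a₁,a₂) ∈ G² realising them;
  -- tuple equality at level h+1 means equality at level h together with
  -- equality of all the counts indexed by pairs of colours (c₁,c₂).
  same : ℕ → Fin n → Fin n → Fin n → Fin n → Bool
  same zero v₁ v₂ u₁ u₂ = eqM (c v₁ v₂) (c u₁ u₂)
  same (suc h) v₁ v₂ u₁ u₂ =
    same h v₁ v₂ u₁ u₂ ∧
    all (λ a₁ → all (λ a₂ → all (λ b₁ → all (λ b₂ →
      count (λ w → same h v₁ w a₁ a₂ ∧ same h w v₂ b₁ b₂)
        ≡ᵇ count (λ w → same h u₁ w a₁ a₂ ∧ same h w u₂ b₁ b₂))
      G) G) G) G

  Stable : ℕ → Set
  Stable h = (v₁ v₂ u₁ u₂ : Fin n) → same (suc h) v₁ v₂ u₁ u₂ ≡ same h v₁ v₂ u₁ u₂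

  IsWL : ℕ → Set
  IsWL h = Stable h × ((j : ℕ) → j < h → ¬ Stable j)

module Submission where

-- WL colours are invariant under right translation, so c^(h)(v₁, v₂) depends only on the
-- quotient v₂ v₁⁻¹, and c^(h) is stable as soon as it separates quotients.  By induction
-- on h, c^(h) separates every quotient of length at most 2^h from all others: a pair
-- (e, b a) with |a|, |b| ≤ 2^(h-1) has the midpoint a, a pair of the same c^(h)-colour has
-- a midpoint x of matching c^(h-1)-colours, and induction identifies x with a and the second
-- half with b.  So h = ⌈log₂ D⌉ suffices.  With unique antipodes, two pairs whose quotients
-- both have length D have the same quotient anyway, so lengths up to D - 1 suffice.

open import Algebra.Bundles using (Group)
open import Algebra.Structures using (IsGroup)
open import Data.Bool using (Bool; true; false; _∧_; if_then_else_; T)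
open import Data.Bool.ListAction using (and; all)
open import Data.Bool.Properties using (T-∧; T-≡) renaming (_≟_ to _≟ᴮ_)
open import Data.Empty using (⊥-elim)
open import Data.Fin using (Fin; zero; suc)
open import Data.Fin.Permutation using (Permutation; permutation; _⟨$⟩ʳ_)
import Data.Fin.Properties as Fin
open import Data.Fin.Subset using (Subset; _∈_)
open import Data.Fin.Subset.Properties using (_∈?_)
open import Data.List using (List; []; _∷_; map; tabulate; allFin)
open import Data.List.Membership.Propositional using () renaming (_∈_ to _∈ₗ_)
open import Data.List.Membership.Propositional.Properties using (∈-allFin)
open import Data.List.Properties using (map-cong; map-tabulate)
open import Data.List.Relation.Unary.All as All using ()
open import Data.List.Relation.Unary.All.Properties using (all⁺; all⁻)
open import Data.List.Relation.Unary.Any using (Any; here; there; satisfied)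
open import Data.List.Relation.Unary.Any.Properties using (any⁻)
open import Data.Maybe using (just; nothing)
open import Data.Nat
  using (ℕ; zero; suc; _+_; _*_; _^_; _∸_; _≤_; _<_; z≤n; s≤s; ⌊_/2⌋; ⌈_/2⌉; _≡ᵇ_)
open import Data.Nat.Induction using (<-wellFounded)
open import Data.Nat.ListAction using (sum)
open import Data.Nat.Logarithm using (⌈log₂_⌉)
open import Data.Nat.Logarithm.Core using (⌈log2⌉)
open import Data.Nat.Properties
open import Data.Product using (_×_; _,_; proj₁; proj₂; ∃-syntax)
open import Data.Sum using (_⊎_; inj₁; inj₂)
open import Defs
open import Function using (id; _∘_; Equivalence; mk⇔)
open import Induction.WellFounded using (Acc; acc)
open import Relation.Binary.PropositionalEquality
open import Relation.Nullary using (Dec; yes; no; does; ¬_; contradiction)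
open import Relation.Nullary.Decidable using (does-⇔)
open import Relation.Unary using (Decidable)
import Algebra.Properties.CommutativeMonoid.Sum +-0-commutativeMonoid as Σ
import Algebra.Properties.Group as GroupProperties

n≤2*⌈n/2⌉ : ∀ n → n ≤ 2 * ⌈ n /2⌉
n≤2*⌈n/2⌉ n = begin
  n                  ≡⟨ ⌊n/2⌋+⌈n/2⌉≡n n ⟨
  ⌊ n /2⌋ + ⌈ n /2⌉  ≤⟨ +-monoˡ-≤ ⌈ n /2⌉ (⌊n/2⌋≤⌈n/2⌉ n) ⟩
  ⌈ n /2⌉ + ⌈ n /2⌉  ≡⟨ cong (⌈ n /2⌉ +_) (+-identityʳ ⌈ n /2⌉) ⟨
  2 * ⌈ n /2⌉        ∎
  where open ≤-Reasoning

n≤2^⌈log2⌉n : ∀ n (rec : Acc _<_ n) → n ≤ 2 ^ ⌈log2⌉ n rec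
n≤2^⌈log2⌉n zero          _        = z≤n
n≤2^⌈log2⌉n (suc zero)    _        = s≤s z≤n
n≤2^⌈log2⌉n (suc (suc n)) (acc rs) =
  ≤-trans (n≤2*⌈n/2⌉ (2 + n)) (*-monoʳ-≤ 2 (n≤2^⌈log2⌉n (suc ⌈ n /2⌉) _))

n≤2^⌈log₂n⌉ : ∀ n → n ≤ 2 ^ ⌈log₂ n ⌉
n≤2^⌈log₂n⌉ n = n≤2^⌈log2⌉n n (<-wellFounded n)

least-witness : {P : ℕ → Set} → Decidable P → ∀ {h} → P h →
                ∃[ w ] (w ≤ h × P w × ((j : ℕ) → j < w → ¬ P j))
least-witness P? {zero} p = 0 , z≤n , p , λ _ ()
least-witness P? {suc h} p with P? 0
... | yes p₀ = 0 , z≤n , p₀ , λ _ ()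
... | no ¬p₀ with least-witness (P? ∘ suc) p
...   | w , w≤h , pw , below = suc w , s≤s w≤h , pw , λ
  { zero    _         → ¬p₀
  ; (suc j) (s≤s j<w) → below j j<w }

T-does⇒ : {A : Set} (a? : Dec A) → T (does a?) → A
T-does⇒ (yes a) _ = a

≡ᵇ-sym : ∀ m n → (m ≡ᵇ n) ≡ (n ≡ᵇ m)
≡ᵇ-sym zero    zero    = refl
≡ᵇ-sym zero    (suc n) = refl
≡ᵇ-sym (suc m) zero    = refl
≡ᵇ-sym (suc m) (suc n) = ≡ᵇ-sym m n

indicator : Bool → ℕ
indicator b = if b then 1 else 0

module _ {A : Set} where

  all-cong : {f g : A → Bool} → (∀ x → f x ≡ g x) → ∀ xs → all f xs ≡ all g xs
  all-cong f≗g xs = cong and (map-cong f≗g xs)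

  all⁴ : (A → A → A → A → Bool) → List A → Bool
  all⁴ f xs = all (λ a → all (λ b → all (λ c → all (λ d → f a b c d) xs) xs) xs) xs

  all⁴-cong : {f g : A → A → A → A → Bool} → (∀ a b c d → f a b c d ≡ g a b c d) →
              ∀ xs → all⁴ f xs ≡ all⁴ g xs
  all⁴-cong f≗g xs =
    all-cong (λ a → all-cong (λ b → all-cong (λ c → all-cong (f≗g a b c) xs) xs) xs) xs

  all⁴-universal : {f : A → A → A → A → Bool} → (∀ a b c d → T (f a b c d)) →
                   ∀ xs → T (all⁴ f xs)
  all⁴-universal holds xs = all⁻ _ (All.universal (λ a → all⁻ _ (All.universal (λ b →
    all⁻ _ (All.universal (λ c → all⁻ _ (All.universal (holds a b c) xs)) xs)) xs)) xs)

  all⁴-lookup : {f : A → A → A → A → Bool} {xs : List A} → T (all⁴ f xs) →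
                ∀ {a b c d} → a ∈ₗ xs → b ∈ₗ xs → c ∈ₗ xs → d ∈ₗ xs → T (f a b c d)
  all⁴-lookup {xs = xs} holds a∈ b∈ c∈ d∈ =
    All.lookup (all⁺ _ xs (All.lookup (all⁺ _ xs (All.lookup (all⁺ _ xs
      (All.lookup (all⁺ _ xs holds) a∈)) b∈)) c∈)) d∈

  ∈⇒0<sum-indicator : (p : A → Bool) {x : A} {xs : List A} → x ∈ₗ xs → T (p x) →
                      0 < sum (map (indicator ∘ p) xs)
  ∈⇒0<sum-indicator p {x} (here refl) px with p x
  ... | true = s≤s z≤n
  ∈⇒0<sum-indicator p (there {x = y} x∈xs) px =
    ≤-trans (∈⇒0<sum-indicator p x∈xs px) (m≤n+m _ (indicator (p y)))

  0<sum-indicator⇒Any : (p : A → Bool) (xs : List A) → 0 < sum (map (indicator ∘ p) xs) →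
                        Any (T ∘ p) xs
  0<sum-indicator⇒Any p (x ∷ xs) pos with p x in eq
  ... | true  = here (Equivalence.from T-≡ eq)
  ... | false = there (0<sum-indicator⇒Any p xs pos)

sum-tabulate : ∀ {n} (f : Fin n → ℕ) → sum (tabulate f) ≡ Σ.sum f
sum-tabulate {zero}  f = refl
sum-tabulate {suc n} f = cong (f zero +_) (sum-tabulate (f ∘ suc))

sum-allFin-permute : ∀ {n} (f : Fin n → ℕ) (π : Permutation n n) →
                     sum (map f (allFin n)) ≡ sum (map (f ∘ (π ⟨$⟩ʳ_)) (allFin n))
sum-allFin-permute {n} f π = begin
  sum (map f (allFin n))               ≡⟨ cong sum (map-tabulate id f) ⟩
  sum (tabulate f)                     ≡⟨ sum-tabulate f ⟩
  Σ.sum f                              ≡⟨ Σ.sum-permute f π ⟩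
  Σ.sum (f ∘ (π ⟨$⟩ʳ_))                 ≡⟨ sum-tabulate (f ∘ (π ⟨$⟩ʳ_)) ⟨
  sum (tabulate (f ∘ (π ⟨$⟩ʳ_)))        ≡⟨ cong sum (map-tabulate id (f ∘ (π ⟨$⟩ʳ_))) ⟨
  sum (map (f ∘ (π ⟨$⟩ʳ_)) (allFin n))  ∎
  where open ≡-Reasoning

module WeisfeilerLeman (n : ℕ) (_∙_ : Fin n → Fin n → Fin n) (e : Fin n) (_⁻¹ : Fin n → Fin n)
                       (isGroup : IsGroup _≡_ _∙_ e _⁻¹) (S : Subset n) where

  open Cayley n _∙_ _⁻¹ S
  open IsGroup isGroup using (_//_; assoc; identityˡ; identityʳ; inverseʳ)
  private
    group : Group _ _
    group = record { isGroup = isGroup }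

  open GroupProperties group
    using (//-rightDividesˡ; //-rightDividesʳ; ⁻¹-anti-homo-∙; ∙-cancelʳ)
  open ≡-Reasoning

  //-translate : ∀ x y z → (y ∙ x) // (z ∙ x) ≡ y // z
  //-translate x y z = begin
    (y ∙ x) ∙ ((z ∙ x) ⁻¹)      ≡⟨ cong ((y ∙ x) ∙_) (⁻¹-anti-homo-∙ z x) ⟩
    (y ∙ x) ∙ ((x ⁻¹) ∙ (z ⁻¹)) ≡⟨ assoc (y ∙ x) (x ⁻¹) (z ⁻¹) ⟨
    ((y ∙ x) // x) ∙ (z ⁻¹)     ≡⟨ cong (_∙ (z ⁻¹)) (//-rightDividesʳ x y) ⟩
    y ∙ (z ⁻¹)                  ∎

  rightTranslation : Fin n → Permutation n n
  rightTranslation x = permutation (_∙ x) (_// x) (//-rightDividesˡ x) (//-rightDividesʳ x)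

  count-translate : ∀ x (P : Fin n → Bool) → count (λ w → P (w ∙ x)) ≡ count P
  count-translate x P = sym (sum-allFin-permute (indicator ∘ P) (rightTranslation x))

  count-cong : {P Q : Fin n → Bool} → (∀ w → P w ≡ Q w) → count P ≡ count Q
  count-cong P≗Q = cong sum (map-cong (cong indicator ∘ P≗Q) G)

  c-translate : ∀ x v₁ v₂ → c (v₁ ∙ x) (v₂ ∙ x) ≡ c v₁ v₂
  c-translate x v₁ v₂ =
    cong (λ q → if does (q ∈? S) then just q else nothing) (//-translate x v₂ v₁)

  eqM-refl : ∀ m → T (eqM m m)
  eqM-refl nothing = _
  eqM-refl (just x) with x Fin.≟ x
  ... | yes _   = _
  ... | no x≢x = x≢x refl

  eqM-sym : ∀ m m′ → eqM m m′ ≡ eqM m′ m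
  eqM-sym (just x) (just y) = does-⇔ (mk⇔ sym sym) (x Fin.≟ y) (y Fin.≟ x)
  eqM-sym (just x) nothing  = refl
  eqM-sym nothing  (just y) = refl
  eqM-sym nothing  nothing  = refl

  c-separates : ∀ {v₁ v₂ u₁ u₂} → (u₂ // u₁) ∈ S → T (eqM (c v₁ v₂) (c u₁ u₂)) →
                v₂ // v₁ ≡ u₂ // u₁
  c-separates {v₁} {v₂} {u₁} {u₂} u∈S same₀ with (v₂ // v₁) ∈? S | (u₂ // u₁) ∈? S
  ... | yes _ | yes _  = T-does⇒ (v₂ // v₁ Fin.≟ u₂ // u₁) same₀
  ... | no _  | yes _  = ⊥-elim same₀
  ... | _     | no u∉S = contradiction u∈S u∉S

  midpoints : ℕ → (v₁ v₂ a₁ a₂ b₁ b₂ : Fin n) → ℕ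
  midpoints h v₁ v₂ a₁ a₂ b₁ b₂ = count (λ w → same h v₁ w a₁ a₂ ∧ same h w v₂ b₁ b₂)

  same-refl : ∀ h v₁ v₂ → T (same h v₁ v₂ v₁ v₂)
  same-refl zero    v₁ v₂ = eqM-refl (c v₁ v₂)
  same-refl (suc h) v₁ v₂ = Equivalence.from T-∧ (same-refl h v₁ v₂ ,
    all⁴-universal (λ a₁ a₂ b₁ b₂ → ≡⇒≡ᵇ _ _ (refl {x = midpoints h v₁ v₂ a₁ a₂ b₁ b₂})) G)

  same-sym : ∀ h v₁ v₂ u₁ u₂ → same h v₁ v₂ u₁ u₂ ≡ same h u₁ u₂ v₁ v₂
  same-sym zero    v₁ v₂ u₁ u₂ = eqM-sym (c v₁ v₂) (c u₁ u₂)
  same-sym (suc h) v₁ v₂ u₁ u₂ = cong₂ _∧_ (same-sym h v₁ v₂ u₁ u₂)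
    (all⁴-cong (λ a₁ a₂ b₁ b₂ →
      ≡ᵇ-sym (midpoints h v₁ v₂ a₁ a₂ b₁ b₂) (midpoints h u₁ u₂ a₁ a₂ b₁ b₂)) G)

  same-translate : ∀ h x v₁ v₂ u₁ u₂ → same h (v₁ ∙ x) (v₂ ∙ x) u₁ u₂ ≡ same h v₁ v₂ u₁ u₂
  same-translate zero    x v₁ v₂ u₁ u₂ = cong (λ m → eqM m (c u₁ u₂)) (c-translate x v₁ v₂)
  same-translate (suc h) x v₁ v₂ u₁ u₂ = cong₂ _∧_ (same-translate h x v₁ v₂ u₁ u₂)
    (all⁴-cong (λ a₁ a₂ b₁ b₂ → cong (_≡ᵇ midpoints h u₁ u₂ a₁ a₂ b₁ b₂) (begin
      midpoints h (v₁ ∙ x) (v₂ ∙ x) a₁ a₂ b₁ b₂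
        ≡⟨ count-translate x _ ⟨
      count (λ w → same h (v₁ ∙ x) (w ∙ x) a₁ a₂ ∧ same h (w ∙ x) (v₂ ∙ x) b₁ b₂)
        ≡⟨ count-cong (λ w → cong₂ _∧_ (same-translate h x v₁ w a₁ a₂)
                                      (same-translate h x w v₂ b₁ b₂)) ⟩
      midpoints h v₁ v₂ a₁ a₂ b₁ b₂ ∎)) G)

  same-normalise : ∀ h v₁ v₂ u₁ u₂ → same h v₁ v₂ u₁ u₂ ≡ same h e (v₂ // v₁) e (u₂ // u₁)
  same-normalise h v₁ v₂ u₁ u₂ = begin
    same h v₁ v₂ u₁ u₂                   ≡⟨ shift v₁ v₂ u₁ u₂ ⟩
    same h e (v₂ // v₁) u₁ u₂            ≡⟨ same-sym h e (v₂ // v₁) u₁ u₂ ⟩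
    same h u₁ u₂ e (v₂ // v₁)            ≡⟨ shift u₁ u₂ e (v₂ // v₁) ⟩
    same h e (u₂ // u₁) e (v₂ // v₁)     ≡⟨ same-sym h e (u₂ // u₁) e (v₂ // v₁) ⟩
    same h e (v₂ // v₁) e (u₂ // u₁)     ∎
    where
    shift : ∀ v₁ v₂ u₁ u₂ → same h v₁ v₂ u₁ u₂ ≡ same h e (v₂ // v₁) u₁ u₂
    shift v₁ v₂ u₁ u₂ = begin
      same h v₁ v₂ u₁ u₂                    ≡⟨ same-translate h (v₁ ⁻¹) v₁ v₂ u₁ u₂ ⟨
      same h (v₁ // v₁) (v₂ // v₁) u₁ u₂
        ≡⟨ cong (λ g → same h g (v₂ // v₁) u₁ u₂) (inverseʳ v₁) ⟩
      same h e (v₂ // v₁) u₁ u₂             ∎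

  //≡⇒same : ∀ h {v₁ v₂ u₁ u₂} → v₂ // v₁ ≡ u₂ // u₁ → T (same h v₁ v₂ u₁ u₂)
  //≡⇒same h {v₁} {v₂} {u₁} {u₂} eq
    rewrite same-normalise h v₁ v₂ u₁ u₂ | eq = same-refl h e (u₂ // u₁)

  data Product : ℕ → Fin n → Set where
    []  : Product 0 e
    _∷_ : ∀ {k s t} → s ∈ S → Product k t → Product (suc k) (s ∙ t)

  _∷ʳ_ : ∀ {k t s} → Product k t → s ∈ S → Product (suc k) (t ∙ s)
  _∷ʳ_ {s = s} []          s∈S =
    subst (Product 1) (trans (identityʳ s) (sym (identityˡ s))) (s∈S ∷ [])
  _∷ʳ_ {s = s} (s′∈S ∷ ss) s∈S = subst (Product _) (sym (assoc _ _ s)) (s′∈S ∷ (ss ∷ʳ s∈S))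

  split : ∀ k {m t} → Product (k + m) t →
          ∃[ t₁ ] ∃[ t₂ ] (Product k t₁ × Product m t₂ × t ≡ t₁ ∙ t₂)
  split zero    {t = t} ss = e , t , [] , ss , sym (identityˡ t)
  split (suc k) (_∷_ {s = s} s∈S ss) with split k ss
  ... | t₁ , t₂ , ss₁ , ss₂ , refl = s ∙ t₁ , t₂ , s∈S ∷ ss₁ , ss₂ , sym (assoc s t₁ t₂)

  walk⇒Product : ∀ k g g′ → T (walk k g g′) → ∃[ t ] (Product k t × g′ ≡ t ∙ g)
  walk⇒Product zero g g′ g≡g′ =
    e , [] , trans (sym (T-does⇒ (g Fin.≟ g′) g≡g′)) (sym (identityˡ g))
  walk⇒Product (suc k) g g′ step with satisfied (any⁻ _ G step)
  ... | s , s∈S∧walk with Equivalence.to T-∧ s∈S∧walk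
  ...   | s∈S , walk-k with walk⇒Product k (s ∙ g) g′ walk-k
  ...     | t , ss , refl = t ∙ s , ss ∷ʳ T-does⇒ (s ∈? S) s∈S , sym (assoc t s g)

  Dist⇒Product : ∀ {q k} → Dist e q k → Product k q
  Dist⇒Product {q} {k} (walk-k , _) with walk⇒Product k e q walk-k
  ... | t , ss , q≡t∙e = subst (Product k) (sym (trans q≡t∙e (identityʳ t))) ss

  same-suc⇒midpoint : ∀ h {v₁ v₂ u₁ u₂} w → T (same (suc h) v₁ v₂ u₁ u₂) →
                      ∃[ x ] T (same h v₁ x u₁ w ∧ same h x v₂ w u₂)
  same-suc⇒midpoint h {v₁} {v₂} {u₁} {u₂} w sameₕ₊₁ =
    satisfied (0<sum-indicator⇒Any _ G (subst (0 <_) (sym midpoints≡) w-is-midpoint))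
    where
    midpoints≡ : midpoints h v₁ v₂ u₁ w w u₂ ≡ midpoints h u₁ u₂ u₁ w w u₂
    midpoints≡ = ≡ᵇ⇒≡ _ _ (all⁴-lookup (proj₂ (Equivalence.to T-∧ sameₕ₊₁))
                   (∈-allFin u₁) (∈-allFin w) (∈-allFin w) (∈-allFin u₂))

    w-is-midpoint : 0 < midpoints h u₁ u₂ u₁ w w u₂
    w-is-midpoint = ∈⇒0<sum-indicator _ (∈-allFin w)
      (Equivalence.from T-∧ (same-refl h u₁ w , same-refl h w u₂))

  same⇒≡ : ∀ h {p q} → T (same h e p e q) → Product (2 ^ h) q → p ≡ q
  same⇒≡ zero {p} same₀ (s∈S ∷ []) =
    ∙-cancelʳ (e ⁻¹) p _ (c-separates (subst (_∈ S) (sym (//-rightDividesʳ e _)) s∈S) same₀)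
  same⇒≡ (suc h) {p} sameₕ₊₁ ss with split (2 ^ h) ss
  ... | b , a , ss-b , ss-a , refl with same-suc⇒midpoint h a sameₕ₊₁
  ...   | x , sameₕ with Equivalence.to T-∧ sameₕ
  ...     | e-x , x-p = begin
    p              ≡⟨ //-rightDividesˡ x p ⟨
    (p // x) ∙ x   ≡⟨ cong₂ _∙_ p//x≡b x≡a ⟩
    b ∙ a          ∎
    where
    x≡a : x ≡ a
    x≡a = same⇒≡ h e-x (subst (λ k → Product k a) (+-identityʳ (2 ^ h)) ss-a)

    p//x≡b : p // x ≡ b
    p//x≡b = same⇒≡ h (subst T normalised x-p) ss-b
      where
      normalised : same h x p a (b ∙ a) ≡ same h e (p // x) e b
      normalised = trans (same-normalise h x p a (b ∙ a))
                         (cong (same h e (p // x) e) (//-rightDividesʳ a b))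

  same⇒//≡ : ∀ h {v₁ v₂ u₁ u₂} → T (same h v₁ v₂ u₁ u₂) → Product (2 ^ h) (u₂ // u₁) →
             v₂ // v₁ ≡ u₂ // u₁
  same⇒//≡ h {v₁} {v₂} {u₁} {u₂} sameₕ =
    same⇒≡ h (subst T (same-normalise h v₁ v₂ u₁ u₂) sameₕ)

  SeparatesQuotients : ℕ → Set
  SeparatesQuotients h = ∀ v₁ v₂ u₁ u₂ → T (same h v₁ v₂ u₁ u₂) → v₂ // v₁ ≡ u₂ // u₁

  separates⇒stable : ∀ h → SeparatesQuotients h → Stable h
  separates⇒stable h separates v₁ v₂ u₁ u₂ with same h v₁ v₂ u₁ u₂ in eq
  ... | false = refl
  ... | true  = Equivalence.to T-≡ (proj₂ (Equivalence.to T-∧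
    (//≡⇒same (suc h) (separates v₁ v₂ u₁ u₂ (Equivalence.from T-≡ eq)))))

  stable? : ∀ h → Dec (Stable h)
  stable? h = Fin.all? λ v₁ → Fin.all? λ v₂ → Fin.all? λ u₁ → Fin.all? λ u₂ →
    same (suc h) v₁ v₂ u₁ u₂ ≟ᴮ same h v₁ v₂ u₁ u₂

  stable⇒WL≤ : ∀ {h} → Stable h → ∃[ w ] (IsWL w × w ≤ h)
  stable⇒WL≤ stable with least-witness stable? stable
  ... | w , w≤h , stable-w , below = w , (stable-w , below) , w≤h

  module _ (e∈S : e ∈ S) where

    pad : ∀ {k m t} → k ≤ m → Product k t → Product m t
    pad {m = zero}  z≤n       []         = []
    pad {m = suc m} z≤n       []         =
      subst (Product (suc m)) (identityˡ e) (e∈S ∷ pad z≤n [])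
    pad             (s≤s k≤m) (s∈S ∷ ss) = s∈S ∷ pad k≤m ss

    module _ (D : ℕ) (diameter : IsDiameter D) where

      short-or-antipodal : ∀ q → Product (D ∸ 1) q ⊎ Dist e q D
      short-or-antipodal q with proj₁ diameter e q
      ... | k , k≤D , dist with m≤n⇒m<n∨m≡n k≤D
      ...   | inj₁ k<D  = inj₁ (pad (suc[m]≤n⇒m≤pred[n] k<D) (Dist⇒Product dist))
      ...   | inj₂ refl = inj₂ dist

      separates-of-diameter : ∀ h → D ≤ 2 ^ h → SeparatesQuotients h
      separates-of-diameter h D≤2^h v₁ v₂ u₁ u₂ sameₕ with proj₁ diameter e (u₂ // u₁)
      ... | k , k≤D , dist = same⇒//≡ h sameₕ (pad (≤-trans k≤D D≤2^h) (Dist⇒Product dist))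

      separates-of-unique-antipodes : ∀ h → UniqueAntipodes D → D ∸ 1 ≤ 2 ^ h →
                                      SeparatesQuotients h
      separates-of-unique-antipodes h unique D∸1≤2^h v₁ v₂ u₁ u₂ sameₕ
        with short-or-antipodal (u₂ // u₁) | short-or-antipodal (v₂ // v₁)
      ... | inj₁ short | _          = same⇒//≡ h sameₕ (pad D∸1≤2^h short)
      ... | inj₂ _     | inj₁ short =
        sym (same⇒//≡ h (subst T (same-sym h v₁ v₂ u₁ u₂) sameₕ) (pad D∸1≤2^h short))
      ... | inj₂ u-far | inj₂ v-far with unique e
      ...   | _ , _ , antipode-unique =
        trans (antipode-unique _ v-far) (sym (antipode-unique _ u-far))

lemma4 : (n : ℕ) (_∙_ : Fin n → Fin n → Fin n) (e : Fin n) (_⁻¹ : Fin n → Fin n)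
  → IsGroup _≡_ _∙_ e _⁻¹
  → (S : Subset n)
  → Cayley.Generates n _∙_ _⁻¹ S
  → e ∈ S
  → ((s : Fin n) → s ∈ S → (s ⁻¹) ∈ S)
  → (D : ℕ) → Cayley.IsDiameter n _∙_ _⁻¹ S D
  → (Cayley.UniqueAntipodes n _∙_ _⁻¹ S D
       → ∃[ w ] (Cayley.IsWL n _∙_ _⁻¹ S w × w ≤ ⌈log₂ (D ∸ 1) ⌉))
  × (¬ Cayley.UniqueAntipodes n _∙_ _⁻¹ S D
       → ∃[ w ] (Cayley.IsWL n _∙_ _⁻¹ S w × w ≤ ⌈log₂ D ⌉))
lemma4 n _∙_ e _⁻¹ isGroup S _ e∈S _ D diameter = with-unique-antipodes , otherwise
  where
  open Cayley n _∙_ _⁻¹ S using (UniqueAntipodes; IsWL)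
  open WeisfeilerLeman n _∙_ e _⁻¹ isGroup S

  with-unique-antipodes : UniqueAntipodes D → ∃[ w ] (IsWL w × w ≤ ⌈log₂ (D ∸ 1) ⌉)
  with-unique-antipodes unique = stable⇒WL≤ (separates⇒stable ⌈log₂ (D ∸ 1) ⌉
    (separates-of-unique-antipodes e∈S D diameter ⌈log₂ (D ∸ 1) ⌉ unique (n≤2^⌈log₂n⌉ (D ∸ 1))))

  otherwise : ¬ UniqueAntipodes D → ∃[ w ] (IsWL w × w ≤ ⌈log₂ D ⌉)
  otherwise _ = stable⇒WL≤ (separates⇒stable ⌈log₂ D ⌉
    (separates-of-diameter e∈S D diameter ⌈log₂ D ⌉ (n≤2^⌈log₂n⌉ D)))
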